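{- Let $n\ge 3$ and $r\ge 3$ be integers. Then for no positive integer $t$ does the OR-power $[M_r(K_n)\setminus\{z\}]^t$ contain a clique of size $n^t$ such that each of its vertices (a sequence of length $t$) has at least one coordinate belonging to $V(K_n)\times\{r-1\}$.
   Context: $K_n$ is the complete graph on $n$ vertices. For a simple graph $G$ and integer $r\ge1$, the $r$-level generalized Mycielskian $M_r(G)$ has vertex set $V(G)\times\{0,1,\dots,r-1\}\cup\{z\}$ ($z$ a new vertex) and edges $\{(v,0),(w,0)\}$ for $\{v,w\}\in E(G)$, $\{(v,i),(w,i+1)\}$ for $\{v,w\}\in E(G)$ and $i\in\{0,\dots,r-2\}$, and $\{z,(v,r-1)\}$ for $v\in V(G)$; $M_r(K_n)\setminus\{z\}$ denotes deletion of $z$. For a graph $H$, $H^t$ is its $t$-fold OR-power: vertex set $V(H)^t$, two distinct sequences adjacent iff in at least one coordinate their entries are adjacent in $H$. -}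

module Defs where

open import Level using (0ℓ)
open import Data.Nat using (ℕ; zero; suc; _+_)
open import Data.Fin using (Fin; toℕ)
open import Data.Product using (Σ; ∃; _×_; _,_; proj₁; proj₂)
open import Data.Sum using (_⊎_)
open import Relation.Binary.PropositionalEquality using (_≡_)
open import Relation.Nullary using (¬_)

record Graph : Set₁ where
  field
    V   : Set
    Adj : V → V → Set

open Graph public

K : ℕ → Graph
K n = record { V = Fin n ; Adj = λ v w → ¬ (v ≡ w) }

-- Generalized Mycielskian M_r(G) with the apex z deleted:
-- vertex set V(G) × {0,…,r-1}; edges (v,0)(w,0) for vw ∈ E(G),
-- and (v,i)(w,i+1) for vw ∈ E(G), 0 ≤ i ≤ r-2 (taken symmetrically).
MycielskianMinusZ : Graph → ℕ → Graph
MycielskianMinusZ G r = record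
  { V   = V G × Fin r
  ; Adj = λ { (v , i) (w , j) → Adj G v w ×
              ((toℕ i ≡ 0 × toℕ j ≡ 0) ⊎ (toℕ j ≡ suc (toℕ i)) ⊎ (toℕ i ≡ suc (toℕ j))) }
  }

ORPower : Graph → ℕ → Graph
ORPower H t = record
  { V   = Fin t → V H
  ; Adj = λ x y → ¬ (x ≡ y) × ∃ λ (k : Fin t) → Adj H (x k) (y k)
  }

IsClique : (G : Graph) {m : ℕ} → (Fin m → V G) → Set
IsClique G {m} c = ∀ (a b : Fin m) → ¬ (a ≡ b) → Adj G (c a) (c b)

{-# OPTIONS --safe #-}
-- Projecting a clique of the OR-power to its K_n-coordinates is injective, because adjacent
-- vertices of M_r(K_n) lie over distinct vertices of K_n; having n^t elements, the clique
-- therefore lies over every sequence in V(K_n)^t exactly once. Take a clique vertex a at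
-- level r-1 in coordinate k, and two further clique vertices b, b′ whose base sequences agree
-- with that of a except at k, where all three are pairwise different (n ≥ 3). These vertices
-- can only be adjacent through coordinate k, so b and b′ both sit at level r-2 there; but two
-- copies at the same nonzero level are never adjacent in M_r(K_n).
module Submission where

open import Defs
open import Data.Nat using (ℕ; _≤_; _^_; suc; _∸_)
open import Data.Fin using (Fin; toℕ)
open import Data.Product using (∃; _×_; proj₂)
open import Relation.Nullary using (¬_)
open import Relation.Binary.PropositionalEquality using (_≡_)

open import Data.Nat using (_<_; s≤s)
open import Data.Nat.Properties using (1+n≰n; 0≢1+n; suc-injective; <-irrefl; n<1+n)
open import Data.Fin using (zero; suc; punchIn; punchOut; funToFin; finToFun)
open import Data.Fin.Properties
  using (_≟_; any?; injective⇒≤; punchOut-injective; punchIn-injective; punchInᵢ≢i; toℕ<n;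
         finToFun-funToFin)
open import Data.Vec.Functional using (updateAt)
open import Data.Vec.Functional.Properties using (updateAt-updates; updateAt-minimal)
open import Data.Product using (_,_; proj₁)
open import Data.Sum using (_⊎_; inj₁; inj₂)
open import Function using (_∘_; const)
open import Function.Definitions using (Injective)
open import Relation.Nullary using (yes; no; contradiction)
open import Relation.Binary.PropositionalEquality
  using (_≢_; _≗_; refl; sym; trans; cong; subst; subst₂; module ≡-Reasoning)

injective⇒surjective : ∀ {m} {f : Fin m → Fin m} → Injective _≡_ _≡_ f →
                       ∀ y → ∃ λ x → f x ≡ y
injective⇒surjective {suc m} {f} f-injective y with any? (λ x → f x ≟ y)
... | yes hit = hit
... | no miss = contradiction (injective⇒≤ f-avoiding-y-injective) 1+n≰n
  where
  f-avoiding-y : Fin (suc m) → Fin m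
  f-avoiding-y x = punchOut (miss ∘ (x ,_) ∘ sym)

  f-avoiding-y-injective : Injective _≡_ _≡_ f-avoiding-y
  f-avoiding-y-injective {x} {x′} =
    f-injective ∘ punchOut-injective (miss ∘ (x ,_) ∘ sym) (miss ∘ (x′ ,_) ∘ sym)

funToFin-injective : ∀ {m n} {f g : Fin m → Fin n} → funToFin f ≡ funToFin g → f ≗ g
funToFin-injective {f = f} {g} eq i = begin
  f i                    ≡⟨ sym (finToFun-funToFin f i) ⟩
  finToFun (funToFin f) i ≡⟨ cong (λ x → finToFun x i) eq ⟩
  finToFun (funToFin g) i ≡⟨ finToFun-funToFin g i ⟩
  g i                    ∎
  where open ≡-Reasoning

ORPower-adjacent-at : ∀ {H t} {x y : Fin t → V H} (k : Fin t) → Adj (ORPower H t) x y →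
                      (∀ j → j ≢ k → ¬ Adj H (x j) (y j)) → Adj H (x k) (y k)
ORPower-adjacent-at k (_ , j , xⱼ~yⱼ) elsewhere with j ≟ k
... | yes refl = xⱼ~yⱼ
... | no j≢k   = contradiction xⱼ~yⱼ (elsewhere j j≢k)

Linked : ℕ → ℕ → Set
Linked i j = (i ≡ 0 × j ≡ 0) ⊎ (j ≡ suc i) ⊎ (i ≡ suc j)

Linked-top : ∀ {l m} → Linked (suc l) m → m < suc (suc l) → m ≡ l
Linked-top (inj₁ (() , _))
Linked-top (inj₂ (inj₁ refl)) m<top  = contradiction m<top (<-irrefl refl)
Linked-top (inj₂ (inj₂ eq))   _      = sym (suc-injective eq)

Linked-self⇒≡0 : ∀ {m} → Linked m m → m ≡ 0
Linked-self⇒≡0 (inj₁ (refl , _))  = refl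
Linked-self⇒≡0 {m} (inj₂ (inj₁ eq)) = contradiction (n<1+n m) (<-irrefl eq)
Linked-self⇒≡0 {m} (inj₂ (inj₂ eq)) = contradiction (n<1+n m) (<-irrefl eq)

module MycielskianClique {n r t : ℕ}
  {c : Fin (n ^ t) → V (ORPower (MycielskianMinusZ (K n) r) t)}
  (clique : IsClique (ORPower (MycielskianMinusZ (K n) r) t) c) where

  base : Fin (n ^ t) → Fin t → Fin n
  base a j = proj₁ (c a j)

  level : Fin (n ^ t) → Fin t → ℕ
  level a j = toℕ (proj₂ (c a j))

  funToFin∘base-injective : Injective _≡_ _≡_ (funToFin ∘ base)
  funToFin∘base-injective {a} {b} eq with a ≟ b
  ... | yes a≡b = a≡b
  ... | no a≢b with clique a b a≢b
  ...   | _ , k , base-differs , _ = contradiction (funToFin-injective eq k) base-differs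

  base-surjective : (y : Fin t → Fin n) → ∃ λ a → base a ≗ y
  base-surjective y with a , eq ← injective⇒surjective funToFin∘base-injective (funToFin y) =
    a , funToFin-injective eq

  linked-at : ∀ {a b} k → base a k ≢ base b k → (∀ j → j ≢ k → base a j ≡ base b j) →
              Linked (level a k) (level b k)
  linked-at {a} {b} k differ agree =
    proj₂ (ORPower-adjacent-at {MycielskianMinusZ (K n) r} k (clique a b a≢b) unlinked)
    where
    a≢b : a ≢ b
    a≢b refl = differ refl

    unlinked : ∀ j → j ≢ k → ¬ Adj (MycielskianMinusZ (K n) r) (c a j) (c b j)
    unlinked j j≢k (base-differs , _) = base-differs (agree j j≢k)

proposition1 : (n r t : ℕ) → 3 ≤ n → 3 ≤ r → 1 ≤ t →
    ¬ (∃ λ (c : Fin (n ^ t) → V (ORPower (MycielskianMinusZ (K n) r) t)) →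
         IsClique (ORPower (MycielskianMinusZ (K n) r) t) c ×
         (∀ (a : Fin (n ^ t)) → ∃ λ (k : Fin t) → toℕ (proj₂ (c a k)) ≡ r ∸ 1))
proposition1 (suc (suc (suc n))) (suc (suc (suc r))) t (s≤s (s≤s (s≤s _))) (s≤s (s≤s (s≤s _))) _
  (c , clique , top) =
  0≢1+n (sym (Linked-self⇒≡0 (subst₂ Linked (variant-level zero) (variant-level (suc zero))
    (linked-at k variants-differ-at-k λ j j≢k →
      trans (variant-elsewhere zero j j≢k) (sym (variant-elsewhere (suc zero) j j≢k))))))
  where
  open MycielskianClique clique

  -- any element of Fin (n ^ t) serves
  a : Fin (suc (suc (suc n)) ^ t)
  a = funToFin {t} (const zero)

  k : Fin t
  k = proj₁ (top a)

  variant : Fin (suc (suc n)) → Fin (suc (suc (suc n)) ^ t)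
  variant i = proj₁ (base-surjective (updateAt (base a) k (const (punchIn (base a k) i))))

  variant-at-k : ∀ i → base (variant i) k ≡ punchIn (base a k) i
  variant-at-k i = trans (proj₂ (base-surjective _) k) (updateAt-updates k (base a))

  variant-elsewhere : ∀ i j → j ≢ k → base (variant i) j ≡ base a j
  variant-elsewhere i j j≢k =
    trans (proj₂ (base-surjective _) j) (updateAt-minimal j k (base a) j≢k)

  variant-level : ∀ i → level (variant i) k ≡ suc r
  variant-level i = Linked-top (subst (λ l → Linked l (level (variant i) k)) (proj₂ (top a))
    (linked-at k (λ eq → punchInᵢ≢i (base a k) i (sym (trans eq (variant-at-k i))))
                 (λ j j≢k → sym (variant-elsewhere i j j≢k))))
    (toℕ<n (proj₂ (c (variant i) k)))

  variants-differ-at-k : base (variant zero) k ≢ base (variant (suc zero)) k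
  variants-differ-at-k eq with () ← punchIn-injective (base a k) zero (suc zero)
    (trans (sym (variant-at-k zero)) (trans eq (variant-at-k (suc zero))))
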